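{- Let $C\subseteq\mathbb{F}_q^n$ be an arbitrary subspace over the finite field $\mathbb{F}_q$. Then $C$ is $\left(1+\frac1q\right)$-non-overlapping.
   Context: For a subspace $C\subseteq\mathbb{F}^n$, $d(C):=\min_{u\in C\setminus\{0\}}\|u\|_0$, where $\|\cdot\|_0$ is the number of nonzero entries. $C$ is $\alpha$-non-overlapping (for $\alpha\ge1$) if for any $u,v\in C$ linearly independent over the field, $|\mathrm{supp}(u)\cup\mathrm{supp}(v)|\ge\alpha\cdot d(C)$. -}

module Defs where

open import Level using (0ℓ)
open import Data.Nat using (ℕ; _*_; _+_; _≤_; suc)
open import Data.Fin using (Fin)
open import Data.List using (List; length; filter)
open import Data.Fin.Base using ()
open import Data.List.Base using ()
open import Data.Product using (Σ; _×_; ∃)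
open import Relation.Nullary using (¬_; ¬?)
open import Relation.Nullary.Decidable using (_⊎-dec_)
open import Relation.Binary.PropositionalEquality using (_≡_; _≢_)
open import Relation.Binary.Definitions using (DecidableEquality)
open import Algebra.Core using (Op₁; Op₂)
open import Algebra.Structures using (IsCommutativeRing)
open import Function.Bundles using (_↔_)
open import Data.Sum using (_⊎_)
import Data.List as L

record FiniteField : Set₁ where
  field
    Carrier : Set
    _+ᶠ_ _*ᶠ_ : Op₂ Carrier
    -ᶠ_ : Op₁ Carrier
    0# 1# : Carrier
    isCommutativeRing : IsCommutativeRing _≡_ _+ᶠ_ _*ᶠ_ -ᶠ_ 0# 1#
    0≢1 : 0# ≢ 1#
    inverse : ∀ x → x ≢ 0# → Σ Carrier (λ y → x *ᶠ y ≡ 1#)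
    _≟_ : DecidableEquality Carrier
    q : ℕ
    enumeration : Fin q ↔ Carrier

module _ (F : FiniteField) where
  open FiniteField F

  Vector : ℕ → Set
  Vector n = Fin n → Carrier

  zeroV : ∀ {n} → Vector n
  zeroV _ = 0#

  _+ᵛ_ : ∀ {n} → Vector n → Vector n → Vector n
  (u +ᵛ v) i = u i +ᶠ v i

  _•_ : ∀ {n} → Carrier → Vector n → Vector n
  (a • u) i = a *ᶠ u i

  NonZero : ∀ {n} → Vector n → Set
  NonZero {n} u = Σ (Fin n) (λ i → u i ≢ 0#)

  weight : ∀ {n} → Vector n → ℕ
  weight {n} u = length (filter (λ i → ¬? (u i ≟ 0#)) (L.allFin n))

  unionSupportSize : ∀ {n} → Vector n → Vector n → ℕ
  unionSupportSize {n} u v =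
    length (filter (λ i → ¬? (u i ≟ 0#) ⊎-dec ¬? (v i ≟ 0#)) (L.allFin n))

  LinearlyIndependent₂ : ∀ {n} → Vector n → Vector n → Set
  LinearlyIndependent₂ {n} u v =
    ∀ a b → (∀ i → ((a • u) +ᵛ (b • v)) i ≡ 0#) → (a ≡ 0#) × (b ≡ 0#)

  record Subspace (n : ℕ) : Set₁ where
    field
      _∈C : Vector n → Set
      respects : ∀ u v → (∀ i → u i ≡ v i) → u ∈C → v ∈C
      zero∈ : zeroV ∈C
      +-closed : ∀ u v → u ∈C → v ∈C → (u +ᵛ v) ∈C
      •-closed : ∀ a u → u ∈C → (a • u) ∈C

  IsMinDistance : ∀ {n} → Subspace n → ℕ → Set
  IsMinDistance {n} C d =
    Σ (Vector n) (λ u → (u ∈C) × NonZero u × (weight u ≡ d))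
    × (∀ u → u ∈C → NonZero u → d ≤ weight u)
    where open Subspace C

  -- C is (a/b)-non-overlapping (b > 0): for all linearly independent u,v ∈ C,
  -- |supp u ∪ supp v| ≥ (a/b)·d(C), written cross-multiplied as a·d(C) ≤ b·|…|.
  NonOverlapping : ∀ {n} → Subspace n → (a b : ℕ) → Set
  NonOverlapping {n} C a b =
    ∀ d → IsMinDistance C d →
    ∀ u v → u ∈C → v ∈C → LinearlyIndependent₂ u v →
    a * d ≤ b * unionSupportSize u v
    where open Subspace C

{-# OPTIONS --safe #-}
-- Let u, v ∈ C be linearly independent. The q + 1 vectors v and u + a v (a ∈ F) are nonzero
-- codewords, so their weights add up to at least (q + 1) d(C). Count the same sum coordinate by
-- coordinate: outside supp u ∪ supp v every one of these vectors vanishes, and inside it at most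
-- q of them are nonzero, because when v i ≠ 0 exactly one a kills u i + a v i, and when v i = 0
-- the vector v itself vanishes there. Hence the sum is also at most q |supp u ∪ supp v|.
module Submission where

open import Defs
open import Data.Nat using (ℕ; suc)
open import Data.Nat.Base using (zero; _+_; _*_; _≤_; z≤n; s≤s)
open import Data.Nat.Properties
  using (+-*-semiring; +-mono-≤; +-suc; *-zeroʳ; *-identityʳ; ≤-trans; ≤-reflexive; module ≤-Reasoning)
open import Data.Bool.Base using (if_then_else_)
open import Data.Fin.Base using (Fin)
import Data.Fin.Base as Fin
open import Data.Fin.Properties using (¬∀⟶∃¬)
open import Data.List.Base using (length; filter; tabulate)
open import Data.Product.Base using (_,_; proj₁; proj₂)
open import Function.Base using (_∘_; id)
open import Function.Bundles using (Inverse)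
open import Relation.Nullary.Negation using (contradiction)
open import Relation.Nullary.Decidable using (Dec; yes; no; does; ¬?; _⊎-dec_)
open import Relation.Unary using (Pred; Decidable)
open import Relation.Binary.PropositionalEquality using (_≡_; _≢_; refl; sym; trans; cong; cong₂; module ≡-Reasoning)
open import Algebra.Bundles using (CommutativeRing)
open import Algebra.Properties.Semiring.Sum +-*-semiring
  using (sum; sum-syntax; sum-cong-≗; sum-replicate-zero; ∑-distrib-+; ∑-comm; *-distribˡ-sum)
import Algebra.Properties.Ring as RingProperties

χ : ∀ {p} {P : Set p} → Dec P → ℕ
χ P? = if does P? then 1 else 0

χ≤1 : ∀ {p} {P : Set p} (P? : Dec P) → χ P? ≤ 1
χ≤1 (yes _) = s≤s z≤n
χ≤1 (no _)  = z≤n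

length-filter-tabulate : ∀ {a p} {A : Set a} {P : Pred A p} (P? : Decidable P) {n} (f : Fin n → A) →
                         length (filter P? (tabulate f)) ≡ ∑[ i < n ] χ (P? (f i))
length-filter-tabulate P? {zero}  f = refl
length-filter-tabulate P? {suc n} f with P? (f Fin.zero)
... | yes _ = cong suc (length-filter-tabulate P? (f ∘ Fin.suc))
... | no _  = length-filter-tabulate P? (f ∘ Fin.suc)

∑-mono-≤ : ∀ {n} {f g : Fin n → ℕ} → (∀ i → f i ≤ g i) → sum f ≤ sum g
∑-mono-≤ {zero}  f≤g = z≤n
∑-mono-≤ {suc n} f≤g = +-mono-≤ (f≤g Fin.zero) (∑-mono-≤ (f≤g ∘ Fin.suc))

∑-const : ∀ n c → ∑[ i < n ] c ≡ n * c
∑-const zero    c = refl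
∑-const (suc n) c = cong (c +_) (∑-const n c)

∑-≤-const : ∀ {n c} {f : Fin n → ℕ} → (∀ i → f i ≤ c) → sum f ≤ n * c
∑-≤-const {n} {c} f≤c = ≤-trans (∑-mono-≤ f≤c) (≤-reflexive (∑-const n c))

∑-≥-const : ∀ {n c} {f : Fin n → ℕ} → (∀ i → c ≤ f i) → n * c ≤ sum f
∑-≥-const {n} {c} c≤f = ≤-trans (≤-reflexive (sym (∑-const n c))) (∑-mono-≤ c≤f)

∑-≤1-with-zero : ∀ {n} (f : Fin n → ℕ) k → (∀ i → f i ≤ 1) → f k ≡ 0 → suc (sum f) ≤ n
∑-≤1-with-zero {suc n} f Fin.zero    f≤1 fk≡0 rewrite fk≡0 =
  s≤s (≤-trans (∑-≤-const (f≤1 ∘ Fin.suc)) (≤-reflexive (*-identityʳ n)))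
∑-≤1-with-zero {suc n} f (Fin.suc k) f≤1 fk≡0 =
  ≤-trans (≤-reflexive (sym (+-suc (f Fin.zero) _)))
          (+-mono-≤ (f≤1 Fin.zero) (∑-≤1-with-zero (f ∘ Fin.suc) k (f≤1 ∘ Fin.suc) fk≡0))

module _ (𝔽 : FiniteField) where
  open FiniteField 𝔽
  open Inverse enumeration using (strictlyInverseˡ) renaming (to to element; from to index)

  private
    ring : CommutativeRing _ _
    ring = record { isCommutativeRing = isCommutativeRing }
    open CommutativeRing ring
      using (+-identityʳ; *-comm; *-assoc; -‿inverseʳ; zeroˡ; zeroʳ)
      renaming (*-identityˡ to *ᶠ-identityˡ; *-identityʳ to *ᶠ-identityʳ)
    open RingProperties (CommutativeRing.ring ring) using (-‿distribˡ-*)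

  χ≢0 : Carrier → ℕ
  χ≢0 x = χ (¬? (x ≟ 0#))

  χ≢0-zero : ∀ {x} → x ≡ 0# → χ≢0 x ≡ 0
  χ≢0-zero {x} x≡0 with x ≟ 0#
  ... | yes _   = refl
  ... | no x≢0 = contradiction x≡0 x≢0

  affine-root : ∀ x {y} (y≢0 : y ≢ 0#) → x +ᶠ ((-ᶠ (x *ᶠ proj₁ (inverse y y≢0))) *ᶠ y) ≡ 0#
  affine-root x {y} y≢0 = begin
    x +ᶠ ((-ᶠ (x *ᶠ y⁻¹)) *ᶠ y)  ≡⟨ cong (x +ᶠ_) (-‿distribˡ-* (x *ᶠ y⁻¹) y) ⟨
    x +ᶠ (-ᶠ ((x *ᶠ y⁻¹) *ᶠ y))  ≡⟨ cong (λ t → x +ᶠ (-ᶠ t)) (*-assoc x y⁻¹ y) ⟩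
    x +ᶠ (-ᶠ (x *ᶠ (y⁻¹ *ᶠ y)))  ≡⟨ cong (λ t → x +ᶠ (-ᶠ (x *ᶠ t))) (trans (*-comm y⁻¹ y) (proj₂ (inverse y y≢0))) ⟩
    x +ᶠ (-ᶠ (x *ᶠ 1#))          ≡⟨ cong (λ t → x +ᶠ (-ᶠ t)) (*ᶠ-identityʳ x) ⟩
    x +ᶠ (-ᶠ x)                  ≡⟨ -‿inverseʳ x ⟩
    0#                           ∎
    where
    open ≡-Reasoning
    y⁻¹ = proj₁ (inverse y y≢0)

  one-root-≤ : ∀ x {y} → y ≢ 0# → suc (∑[ a < q ] χ≢0 (x +ᶠ (element a *ᶠ y))) ≤ q * 1
  one-root-≤ x {y} y≢0 = ≤-trans
    (∑-≤1-with-zero _ (index root) (λ a → χ≤1 (¬? ((x +ᶠ (element a *ᶠ y)) ≟ 0#)))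
      (χ≢0-zero (trans (cong (λ c → x +ᶠ (c *ᶠ y)) (strictlyInverseˡ root)) (affine-root x y≢0))))
    (≤-reflexive (sym (*-identityʳ q)))
    where root = -ᶠ (x *ᶠ proj₁ (inverse y y≢0))

  nonzeros-on-line-≤ : ∀ x y → χ≢0 y + ∑[ a < q ] χ≢0 (x +ᶠ (element a *ᶠ y))
                               ≤ q * χ (¬? (x ≟ 0#) ⊎-dec ¬? (y ≟ 0#))
  nonzeros-on-line-≤ x y with x ≟ 0# | y ≟ 0#
  ... | yes x≡0 | yes y≡0 = ≤-reflexive (begin
    ∑[ a < q ] χ≢0 (x +ᶠ (element a *ᶠ y)) ≡⟨ sum-cong-≗ (λ a → χ≢0-zero (vanishes a)) ⟩
    ∑[ a < q ] 0                           ≡⟨ sum-replicate-zero q ⟩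
    0                                      ≡⟨ *-zeroʳ q ⟨
    q * 0                                  ∎)
    where
    open ≡-Reasoning
    vanishes : ∀ a → x +ᶠ (element a *ᶠ y) ≡ 0#
    vanishes a = trans (cong₂ _+ᶠ_ x≡0 (trans (cong (element a *ᶠ_) y≡0) (zeroʳ _))) (+-identityʳ 0#)
  ... | no _    | yes _   = ∑-≤-const (λ a → χ≤1 (¬? ((x +ᶠ (element a *ᶠ y)) ≟ 0#)))
  ... | yes _   | no y≢0 = one-root-≤ x y≢0
  ... | no _    | no y≢0 = one-root-≤ x y≢0

  module _ {n : ℕ} where

    weight≡∑χ≢0 : (u : Vector 𝔽 n) → weight 𝔽 u ≡ ∑[ i < n ] χ≢0 (u i)
    weight≡∑χ≢0 u = length-filter-tabulate (λ i → ¬? (u i ≟ 0#)) id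

    pencil-weight-≤ : (u v : Vector 𝔽 n) →
      weight 𝔽 v + ∑[ a < q ] weight 𝔽 (_+ᵛ_ 𝔽 u (_•_ 𝔽 (element a) v)) ≤ q * unionSupportSize 𝔽 u v
    pencil-weight-≤ u v = begin
      weight 𝔽 v + ∑[ a < q ] weight 𝔽 (_+ᵛ_ 𝔽 u (_•_ 𝔽 (element a) v))
        ≡⟨ cong₂ _+_ (weight≡∑χ≢0 v) (sum-cong-≗ (λ a → weight≡∑χ≢0 (_+ᵛ_ 𝔽 u (_•_ 𝔽 (element a) v)))) ⟩
      ∑[ i < n ] χ≢0 (v i) + ∑[ a < q ] ∑[ i < n ] χ≢0 (u i +ᶠ (element a *ᶠ v i))
        ≡⟨ cong (∑[ i < n ] χ≢0 (v i) +_) (∑-comm (λ a i → χ≢0 (u i +ᶠ (element a *ᶠ v i)))) ⟩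
      ∑[ i < n ] χ≢0 (v i) + ∑[ i < n ] ∑[ a < q ] χ≢0 (u i +ᶠ (element a *ᶠ v i))
        ≡⟨ ∑-distrib-+ (λ i → χ≢0 (v i)) _ ⟨
      ∑[ i < n ] (χ≢0 (v i) + ∑[ a < q ] χ≢0 (u i +ᶠ (element a *ᶠ v i)))
        ≤⟨ ∑-mono-≤ (λ i → nonzeros-on-line-≤ (u i) (v i)) ⟩
      ∑[ i < n ] (q * χ (¬? (u i ≟ 0#) ⊎-dec ¬? (v i ≟ 0#)))
        ≡⟨ *-distribˡ-sum q (λ i → χ (¬? (u i ≟ 0#) ⊎-dec ¬? (v i ≟ 0#))) ⟨
      q * ∑[ i < n ] χ (¬? (u i ≟ 0#) ⊎-dec ¬? (v i ≟ 0#))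
        ≡⟨ cong (q *_) (length-filter-tabulate (λ i → ¬? (u i ≟ 0#) ⊎-dec ¬? (v i ≟ 0#)) id) ⟨
      q * unionSupportSize 𝔽 u v
        ∎
      where open ≤-Reasoning

    module _ {u v : Vector 𝔽 n} (independent : LinearlyIndependent₂ 𝔽 u v) where

      independent⇒NonZeroʳ : NonZero 𝔽 v
      independent⇒NonZeroʳ = ¬∀⟶∃¬ n _ (λ i → v i ≟ 0#) λ v≡0 →
        0≢1 (sym (proj₂ (independent 0# 1# λ i →
          trans (cong₂ _+ᶠ_ (zeroˡ (u i)) (trans (*ᶠ-identityˡ (v i)) (v≡0 i))) (+-identityʳ 0#))))

      independent⇒NonZero-+• : ∀ a → NonZero 𝔽 (_+ᵛ_ 𝔽 u (_•_ 𝔽 a v))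
      independent⇒NonZero-+• a = ¬∀⟶∃¬ n _ (λ i → (u i +ᶠ (a *ᶠ v i)) ≟ 0#) λ w≡0 →
        0≢1 (sym (proj₁ (independent 1# a λ i → trans (cong (_+ᶠ (a *ᶠ v i)) (*ᶠ-identityˡ (u i))) (w≡0 i))))

lemma2p7 : (F : FiniteField) (n : ℕ) (C : Subspace F n) →
           NonOverlapping F C (suc (FiniteField.q F)) (FiniteField.q F)
lemma2p7 F n C d (_ , minimal) u v u∈C v∈C independent = begin
  d + q * d
    ≤⟨ +-mono-≤ (minimal v v∈C (independent⇒NonZeroʳ F independent))
                (∑-≥-const λ a → minimal _ (+-closed u _ u∈C (•-closed (element a) v v∈C))
                                           (independent⇒NonZero-+• F independent (element a))) ⟩
  weight F v + ∑[ a < q ] weight F (_+ᵛ_ F u (_•_ F (element a) v))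
    ≤⟨ pencil-weight-≤ F u v ⟩
  q * unionSupportSize F u v
    ∎
  where
  open FiniteField F using (q; enumeration)
  open Inverse enumeration renaming (to to element)
  open Subspace C
  open ≤-Reasoning
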